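{- Let $(p:W\to A,q:W\to B)$ and $(p':W'\to B,q':W'\to D)$ be weakening-closed spans in $\mathsf{Pos}$, and let $(r:V\to W,s:V\to W')$ be the comma span of the cospan $(q,p')$. Then the span $(p\circ r,q'\circ s)$ is weakening-closed.
   Context: $\mathsf{Pos}$ is the category of posets and monotone maps. The comma of a cospan $W\xrightarrow{q}B\xleftarrow{p'}W'$ is $V=\{(w,w')\mid q(w)\le p'(w')\}$ with the order inherited from $W\times W'$ and the two projections $r,s$. A span $(p:W\to A,q:W\to B)$ is weakening-closed if the canonical map from $W$ to the graph $\{(a,b)\mid \exists w.\ a\le p(w),\ q(w)\le b\}$ of the relation it represents, $w\mapsto(p(w),q(w))$, is onto; i.e. whenever $a\le p(w)$ and $q(w)\le b$ there is $w'\in W$ with $p(w')=a$ and $q(w')=b$. -}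

module Defs where

open import Level using (Level; _⊔_)
open import Data.Product using (Σ; Σ-syntax; _×_; _,_; proj₁; proj₂; ∃; ∃-syntax)
open import Relation.Binary.Bundles using (Poset)
open import Relation.Binary.Structures using (IsPartialOrder; IsPreorder; IsEquivalence)
open import Relation.Binary.PropositionalEquality as ≡ using (_≡_)


record Mono {c e ℓ c' e' ℓ'} (P : Poset c e ℓ) (Q : Poset c' e' ℓ') : Set (c ⊔ e ⊔ ℓ ⊔ c' ⊔ e' ⊔ ℓ') where
  constructor mono
  field
    fun : Poset.Carrier P → Poset.Carrier Q
    cong : ∀ {x y} → Poset._≈_ P x y → Poset._≈_ Q (fun x) (fun y)
    monotone : ∀ {x y} → Poset._≤_ P x y → Poset._≤_ Q (fun x) (fun y)
open Mono public

_∘M_ : ∀ {a a' b c c' d e e' f} {P : Poset a a' b} {Q : Poset c c' d} {R : Poset e e' f}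
     → Mono Q R → Mono P Q → Mono P R
g ∘M f = mono (λ x → fun g (fun f x)) (λ x≈y → cong g (cong f x≈y))
              (λ x≤y → monotone g (monotone f x≤y))

WeakeningClosed : ∀ {cw ew ℓw ca ea ℓa cb eb ℓb}
  {W : Poset cw ew ℓw} {A : Poset ca ea ℓa} {B : Poset cb eb ℓb}
  → Mono W A → Mono W B → Set _
WeakeningClosed {W = W} {A} {B} p q =
  ∀ (a : Poset.Carrier A) (b : Poset.Carrier B) (w : Poset.Carrier W)
  → Poset._≤_ A a (fun p w) → Poset._≤_ B (fun q w) b
  → Σ[ w' ∈ Poset.Carrier W ]
      (Poset._≈_ A (fun p w') a × Poset._≈_ B (fun q w') b)

-- The comma poset of a cospan W --q--> B <--p'-- W' :
-- V = {(w,w') | q w ≤ p' w'} with the order (and equality) inherited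
-- from W × W' (componentwise; the proof of q w ≤ p' w' is ignored).
module Comma {cw ew ℓw cb eb ℓb cw' ew' ℓw'}
  {W : Poset cw ew ℓw} {B : Poset cb eb ℓb} {W' : Poset cw' ew' ℓw'}
  (q : Mono W B) (p' : Mono W' B) where

  private
    module W = Poset W
    module W' = Poset W'
    module B = Poset B

  VCarrier : Set _
  VCarrier = Σ[ ww' ∈ W.Carrier × W'.Carrier ] (fun q (proj₁ ww') B.≤ fun p' (proj₂ ww'))

  _≈V_ : VCarrier → VCarrier → Set _
  ((w₁ , w₁') , _) ≈V ((w₂ , w₂') , _) = (w₁ W.≈ w₂) × (w₁' W'.≈ w₂')

  _≤V_ : VCarrier → VCarrier → Set _
  ((w₁ , w₁') , _) ≤V ((w₂ , w₂') , _) = (w₁ W.≤ w₂) × (w₁' W'.≤ w₂')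

  V : Poset _ _ _
  V = record
    { Carrier = VCarrier
    ; _≈_ = _≈V_
    ; _≤_ = _≤V_
    ; isPartialOrder = record
      { isPreorder = record
        { isEquivalence = record
          { refl = W.Eq.refl , W'.Eq.refl
          ; sym = λ (e , e') → W.Eq.sym e , W'.Eq.sym e'
          ; trans = λ (e , e') (f , f') → W.Eq.trans e f , W'.Eq.trans e' f'
          }
        ; reflexive = λ (e , e') → W.reflexive e , W'.reflexive e'
        ; trans = λ (e , e') (f , f') → W.trans e f , W'.trans e' f'
        }
      ; antisym = λ (e , e') (f , f') → W.antisym e f , W'.antisym e' f'
      }
    }

  r : Mono V W
  r = mono (λ v → proj₁ (proj₁ v)) proj₁ proj₁

  s : Mono V W'
  s = mono (λ v → proj₂ (proj₁ v)) proj₂ proj₂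

module Submission where

open import Defs
open import Relation.Binary.Bundles using (Poset)
open import Data.Product using (Σ-syntax; _×_; _,_)

-- Weaken the two outer legs separately: the first span moves a below p w while
-- keeping q w, the second moves d above q' w' while keeping p' w'. The new pair
-- stays in the comma, since q w₁ ≈ q w ≤ p' w' ≈ p' w₁'.

module _ {cw ew ℓw ca ea ℓa cb eb ℓb}
  {W : Poset cw ew ℓw} {A : Poset ca ea ℓa} {B : Poset cb eb ℓb}
  (p : Mono W A) (q : Mono W B) (closed : WeakeningClosed p q) where

  private
    module A = Poset A
    module B = Poset B

  weakenˡ : ∀ {a w} → a A.≤ fun p w
          → Σ[ w₁ ∈ Poset.Carrier W ] (fun p w₁ A.≈ a × fun q w₁ B.≈ fun q w)
  weakenˡ {a} {w} a≤p = closed a (fun q w) w a≤p B.refl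

  weakenʳ : ∀ {b w} → fun q w B.≤ b
          → Σ[ w₁ ∈ Poset.Carrier W ] (fun p w₁ A.≈ fun p w × fun q w₁ B.≈ b)
  weakenʳ {b} {w} q≤b = closed (fun p w) b w A.refl q≤b

proposition3p12 : ∀ {ca ea ℓa cb eb ℓb cd ed ℓd cw ew ℓw cw' ew' ℓw'}
    {A : Poset ca ea ℓa} {B : Poset cb eb ℓb} {D : Poset cd ed ℓd}
    {W : Poset cw ew ℓw} {W' : Poset cw' ew' ℓw'}
    (p : Mono W A) (q : Mono W B) (p' : Mono W' B) (q' : Mono W' D)
    → WeakeningClosed p q → WeakeningClosed p' q'
    → WeakeningClosed {W = Comma.V q p'} (p ∘M Comma.r q p') (q' ∘M Comma.s q p')
proposition3p12 {B = B} p q p' q' closed closed' a d ((w , w') , q≤p') a≤p q'≤d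
  with weakenˡ p q closed a≤p | weakenʳ p' q' closed' q'≤d
... | w₁ , p₁≈a , q₁≈q | w₁' , p'₁≈p' , q'₁≈d = ((w₁ , w₁') , q₁≤p'₁) , p₁≈a , q'₁≈d
  where
    open Poset B using (_≤_; ≤-respˡ-≈; ≤-respʳ-≈; module Eq)
    q₁≤p'₁ : fun q w₁ ≤ fun p' w₁'
    q₁≤p'₁ = ≤-respʳ-≈ (Eq.sym p'₁≈p') (≤-respˡ-≈ (Eq.sym q₁≈q) q≤p')
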